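{- Let $i\in\mathbb N$ and, for $j\in\mathbb Z$, let $P_j=\{j,j+1,j+2,\dots\}$. Define $\mathcal C_1^i=\bigcup_{j\in\mathbb N}\{\{0,\dots,i\}\cup A\cup P_j \mid A\subseteq\mathbb Z\}$, $\mathcal C_2^i=\{A\cup\mathbb Z_{<0}\mid A\subseteq\mathbb Z\setminus\{0,\dots,i\}\}$ and $\mathcal C^i=\mathcal C_1^i\cup\mathcal C_2^i$. Then $\mathcal C^i$ is generatable in the limit with $i$ omissions.
   Context: Collections are over the universe $\mathbb Z$; a language is an infinite subset of $\mathbb Z$. A generator algorithm is an arbitrary function $G$ from finite sequences of integers to integers, with output $z_t=G(x_0,\dots,x_t)$, and $S_t=\{x_0,\dots,x_t\}$. An enumeration of $K$ with $i$ omissions is an infinite sequence $x_0,x_1,\dots$ of pairwise distinct elements with $\bigcup_k\{x_k\}\subseteq K$ and $|K\setminus\bigcup_k\{x_k\}|\le i$. $G$ generates in the limit with $i$ omissions for $\mathcal C$ if for every $K\in\mathcal C$ and every enumeration of $K$ with $i$ omissions there is $t^\star$ such that $z_t\in K\setminus S_t$ for all $t\ge t^\star$. -}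

module Defs where

open import Level using (0ℓ)
open import Data.Nat using (ℕ; suc) renaming (_≤_ to _≤ℕ_)
open import Data.Integer using (ℤ; +_; _≤_; _<_)
open import Data.List using (List; map; upTo; length)
open import Data.List.Membership.Propositional using (_∈_)
open import Data.Product using (Σ; ∃; _×_)
open import Data.Sum using (_⊎_)
open import Relation.Nullary using (¬_)
open import Relation.Binary.PropositionalEquality using (_≡_)

Language : Set₁
Language = ℤ → Set

Collection : Set₂
Collection = Language → Set₁

_≐_ : Language → Language → Set
K ≐ L = ∀ z → (K z → L z) × (L z → K z)

Generator : Set
Generator = List ℤ → ℤ

prefix : (ℕ → ℤ) → ℕ → List ℤ
prefix x t = map x (upTo (suc t))

S : (ℕ → ℤ) → ℕ → Language
S x t z = ∃ λ k → k ≤ℕ t × x k ≡ z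

-- x is an enumeration of K with i omissions: pairwise distinct elements of K,
-- and all elements of K not occurring in x lie in a list of length at most i
-- (i.e. |K ∖ ⋃ₖ {xₖ}| ≤ i).
EnumerationWithOmissions : Language → ℕ → (ℕ → ℤ) → Set
EnumerationWithOmissions K i x =
  (∀ m n → x m ≡ x n → m ≡ n) ×
  (∀ k → K (x k)) ×
  Σ (List ℤ) λ L → length L ≤ℕ i × (∀ z → K z → (∃ λ k → x k ≡ z) ⊎ z ∈ L)

GeneratesInLimitWithOmissions : ℕ → Collection → Generator → Set₁
GeneratesInLimitWithOmissions i 𝒞 G =
  ∀ (K : Language) → 𝒞 K → ∀ (x : ℕ → ℤ) → EnumerationWithOmissions K i x →
  ∃ λ t⋆ → ∀ t → t⋆ ≤ℕ t → K (G (prefix x t)) × ¬ S x t (G (prefix x t))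

GeneratableInLimitWithOmissions : ℕ → Collection → Set₁
GeneratableInLimitWithOmissions i 𝒞 = Σ Generator (GeneratesInLimitWithOmissions i 𝒞)

Init : ℕ → Language
Init i z = (+ 0 ≤ z) × (z ≤ + i)

P : ℤ → Language
P j z = j ≤ z

𝒞₁ : ℕ → Collection
𝒞₁ i K = Σ ℕ λ j → Σ Language λ A → K ≐ (λ z → Init i z ⊎ A z ⊎ P (+ j) z)

𝒞₂ : ℕ → Collection
𝒞₂ i K = Σ Language λ A → (∀ z → A z → ¬ Init i z) × K ≐ (λ z → A z ⊎ z < + 0)

𝒞 : ℕ → Collection
𝒞 i K = 𝒞₁ i K ⊎ 𝒞₂ i K

-- The generator answers with an integer of absolute value larger than every
-- element seen so far, so its answer is always fresh; only the sign needs
-- care. Once some element of {0, …, i} has appeared the answer is positive,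
-- otherwise negative. A language of 𝒞₂ⁱ contains no element of {0, …, i} but
-- all negative integers, so the negative answers are correct. A language of
-- 𝒞₁ⁱ contains all of the i + 1 elements of {0, …, i}; as at most i elements
-- are omitted, one of them is eventually enumerated, after which the answers
-- are positive and, growing with the length of the prefix, eventually lie in
-- the tail P_j ⊆ K.
module Submission where

open import Defs
open import Data.Nat using (ℕ; suc; z≤n; s≤s; _+_; _⊔_) renaming (_≤_ to _≤ℕ_; _<_ to _<ℕ_)
open import Data.Nat.Properties
  using (≤-refl; ≤-trans; m≤m+n; m≤n+m; n≤1+n; m≤m⊔n; m≤n⊔m; <⇒≱)
open import Data.Integer using (ℤ; +_; -[1+_]; ∣_∣; +≤+; -<+; _≟_) renaming (_≤?_ to _≤ℤ?_)
open import Data.Integer.Properties using (+-injective; <-≤-trans; <-irrefl)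
open import Data.Fin using (Fin; toℕ)
open import Data.Fin.Properties using (¬∀⟶∃¬; injective⇒≤; toℕ-injective; toℕ≤pred[n])
open import Data.List using (List; []; _∷_; map; upTo; length; lookup)
open import Data.List.Properties using (length-map; length-upTo)
open import Data.List.Relation.Unary.Any using (Any; here; there; any?; index)
open import Data.List.Relation.Unary.Any.Properties using (lookup-index)
open import Data.List.Membership.Propositional using (_∈_; _∉_; lose; find)
open import Data.List.Membership.Propositional.Properties using (∈-map⁺; ∈-map⁻; ∈-upTo⁺)
open import Data.Product using (∃; _×_; _,_; proj₁; proj₂)
open import Data.Sum using (inj₁; inj₂)
open import Data.Empty using (⊥-elim)
open import Function.Base using (_∘′_)
open import Function.Definitions using (Injective)
open import Relation.Binary.Definitions using (DecidableEquality)
open import Relation.Nullary using (¬_; Dec; yes; no)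
open import Relation.Nullary.Decidable using (_×-dec_)
open import Relation.Binary.PropositionalEquality using (_≡_; refl; sym; trans; cong; subst)

module _ {A : Set} (_≟ᴬ_ : DecidableEquality A) where
  open import Data.List.Membership.DecPropositional _≟ᴬ_ using () renaming (_∈?_ to _∈ᴬ?_)

  injective⇒∃∉ : ∀ {m} {f : Fin m → A} → Injective _≡_ _≡_ f →
                 (L : List A) → length L <ℕ m → ∃ λ k → f k ∉ L
  injective⇒∃∉ {m} {f} f-inj L |L|<m = ¬∀⟶∃¬ m (λ k → f k ∈ L) (λ k → f k ∈ᴬ? L)
    (λ f⊆L → <⇒≱ |L|<m (injective⇒≤ (index-injective f⊆L)))
    where
    index-injective : (f⊆L : ∀ k → f k ∈ L) → Injective _≡_ _≡_ (λ k → index (f⊆L k))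
    index-injective f⊆L {a} {b} eq =
      f-inj (trans (lookup-index (f⊆L a)) (trans (cong (lookup L) eq) (sym (lookup-index (f⊆L b)))))

bound : List ℤ → ℕ
bound []      = 0
bound (y ∷ l) = suc (∣ y ∣ + bound l)

∈⇒∣∣<bound : ∀ {y l} → y ∈ l → ∣ y ∣ <ℕ bound l
∈⇒∣∣<bound {l = y ∷ l} (here refl) = s≤s (m≤m+n ∣ y ∣ (bound l))
∈⇒∣∣<bound {l = y ∷ l} (there y∈l) = ≤-trans (∈⇒∣∣<bound y∈l) (≤-trans (m≤n+m _ ∣ y ∣) (n≤1+n _))

bound≤∣∣⇒∉ : ∀ {z} l → bound l ≤ℕ ∣ z ∣ → z ∉ l
bound≤∣∣⇒∉ l bound≤∣z∣ z∈l = <⇒≱ (∈⇒∣∣<bound z∈l) bound≤∣z∣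

length≤bound : ∀ l → length l ≤ℕ bound l
length≤bound []      = z≤n
length≤bound (y ∷ l) = s≤s (≤-trans (length≤bound l) (m≤n+m _ ∣ y ∣))

Init? : ∀ i z → Dec (Init i z)
Init? i z = (+ 0 ≤ℤ? z) ×-dec (z ≤ℤ? + i)

generator : ℕ → Generator
generator i l with any? (Init? i) l
... | yes _ = + bound l
... | no  _ = -[1+ bound l ]

bound≤∣generator∣ : ∀ i l → bound l ≤ℕ ∣ generator i l ∣
bound≤∣generator∣ i l with any? (Init? i) l
... | yes _ = ≤-refl
... | no  _ = n≤1+n _

generator-seen : ∀ i l → Any (Init i) l → generator i l ≡ + bound l
generator-seen i l seen with any? (Init? i) l
... | yes _      = refl
... | no  unseen = ⊥-elim (unseen seen)

generator-unseen : ∀ i l → ¬ Any (Init i) l → generator i l ≡ -[1+ bound l ]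
generator-unseen i l unseen with any? (Init? i) l
... | yes seen = ⊥-elim (unseen seen)
... | no  _    = refl

∈-prefix⁺ : ∀ x {k t} → k ≤ℕ t → x k ∈ prefix x t
∈-prefix⁺ x k≤t = ∈-map⁺ x (∈-upTo⁺ (s≤s k≤t))

∈-prefix⁻ : ∀ x {z} t → z ∈ prefix x t → ∃ λ k → x k ≡ z
∈-prefix⁻ x t z∈ with k , _ , refl ← ∈-map⁻ x z∈ = k , refl

length-prefix : ∀ x t → length (prefix x t) ≡ suc t
length-prefix x t = trans (length-map x (upTo (suc t))) (length-upTo (suc t))

generator-fresh : ∀ i x t → ¬ S x t (generator i (prefix x t))
generator-fresh i x t (k , k≤t , xk≡g) =
  bound≤∣∣⇒∉ (prefix x t) (bound≤∣generator∣ i (prefix x t))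
    (subst (_∈ prefix x t) xk≡g (∈-prefix⁺ x k≤t))

toℕ∈Init : ∀ {i} (m : Fin (suc i)) → Init i (+ toℕ m)
toℕ∈Init m = +≤+ z≤n , +≤+ (toℕ≤pred[n] m)

GeneratesInLimitFor : ℕ → Generator → Language → Set
GeneratesInLimitFor i G K = ∀ x → EnumerationWithOmissions K i x →
  ∃ λ t⋆ → ∀ t → t⋆ ≤ℕ t → K (G (prefix x t)) × ¬ S x t (G (prefix x t))

generates-𝒞₂ : ∀ i {K} → 𝒞₂ i K → GeneratesInLimitFor i (generator i) K
generates-𝒞₂ i {K} (A , A∩Init≡∅ , K≐A∪neg) x (_ , x∈K , _) = 0 , λ t _ →
  subst K (sym (generator-unseen i (prefix x t) (unseen t))) (proj₂ (K≐A∪neg _) (inj₂ -<+))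
  , generator-fresh i x t
  where
  K∩Init≡∅ : ∀ z → K z → ¬ Init i z
  K∩Init≡∅ z Kz with proj₁ (K≐A∪neg z) Kz
  ... | inj₁ Az  = A∩Init≡∅ z Az
  ... | inj₂ z<0 = λ (0≤z , _) → <-irrefl refl (<-≤-trans z<0 0≤z)

  unseen : ∀ t → ¬ Any (Init i) (prefix x t)
  unseen t seen with z , z∈ , Init-z ← find seen with k , refl ← ∈-prefix⁻ x t z∈ =
    K∩Init≡∅ (x k) (x∈K k) Init-z

generates-𝒞₁ : ∀ i {K} → 𝒞₁ i K → GeneratesInLimitFor i (generator i) K
generates-𝒞₁ i {K} (j , A , K≐Init∪A∪P) x (_ , _ , L , |L|≤i , covered)
  with m , m∉L ← injective⇒∃∉ _≟_ (toℕ-injective ∘′ +-injective) L (s≤s |L|≤i)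
  with covered (+ toℕ m) (proj₂ (K≐Init∪A∪P _) (inj₁ (toℕ∈Init m)))
... | inj₂ m∈L = ⊥-elim (m∉L m∈L)
... | inj₁ (k , xk≡m) = k ⊔ j , λ t k⊔j≤t →
  subst K (sym (generator-seen i (prefix x t) (seen t (≤-trans (m≤m⊔n k j) k⊔j≤t))))
        (proj₂ (K≐Init∪A∪P _) (inj₂ (inj₂ (+≤+ (j≤bound t (≤-trans (m≤n⊔m k j) k⊔j≤t))))))
  , generator-fresh i x t
  where
  seen : ∀ t → k ≤ℕ t → Any (Init i) (prefix x t)
  seen t k≤t = lose (∈-prefix⁺ x k≤t) (subst (Init i) (sym xk≡m) (toℕ∈Init m))

  j≤bound : ∀ t → j ≤ℕ t → j ≤ℕ bound (prefix x t)
  j≤bound t j≤t = ≤-trans (≤-trans j≤t (n≤1+n t))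
    (subst (_≤ℕ bound (prefix x t)) (length-prefix x t) (length≤bound (prefix x t)))

lemma4p8 : ∀ (i : ℕ) → GeneratableInLimitWithOmissions i (𝒞 i)
lemma4p8 i = generator i , λ where
  K (inj₁ K∈𝒞₁) → generates-𝒞₁ i K∈𝒞₁
  K (inj₂ K∈𝒞₂) → generates-𝒞₂ i K∈𝒞₂
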